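{- Let $1\le k<n$. For every $S\in\Theta(k,2n)$, $F_k(S)\in\tilde P(n-k,n)$ (in particular $(S^{(1)}_i+S^{(2)}_i)_i$ has a part equal to $n-k$ if and only if $S^{(1)}$ does), and $F_k:\Theta(k,2n)\to\tilde P(n-k,n)$ is injective.
   Context: Type $D_n$ positive roots $e_a\pm e_b$ ($a<b$), ordered by $\alpha\preceq\alpha'$ iff $\alpha'-\alpha$ is a nonnegative combination of simple roots $e_i-e_{i+1}$ ($i<n$), $e_{n-1}+e_n$. $\Lambda_k$ = base $\{e_a\pm e_c:a\le k<c\}$ $\cup$ top $\{e_a+e_b:a<b\le k\}$; $D(a)=\{e_a\pm e_c:c>k\}$. $\Theta(k,2n)$: $S\subseteq\Lambda_k$ meeting each of the base and top regions in a lower order ideal, with, for $a<b\le k$, $e_a+e_b\in S$ if $|S\cap D(a)|+|S\cap D(b)|>2n-2k$ and $e_a+e_b\notin S$ if this sum is $<2n-2k$. For $S\subseteq\Lambda_k$: $S^{(1)}_i=|S\cap D(k+1-i)|$, $S^{(2)}_i=|\{a<k+1-i:e_a+e_{k+1-i}\in S\}|$; if $S^{(1)}_i=n-k$ for some $i$, $S$ is assigned $\uparrow$ if $e_{k+1-i}-e_n\in S$, $\downarrow$ if $e_{k+1-i}+e_n\in S$. $F_k(S)=((S^{(1)}_i+S^{(2)}_i)_{1\le i\le k};t)$ with $t=1$ if $\uparrow$, $t=2$ if $\downarrow$, $t=0$ otherwise. $\tilde P(n-k,n)$: pairs $(\gamma;t)$ with $\gamma$ a partition with at most $k$ parts, each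 $\le 2n-1-k$, $\gamma_i>\gamma_{i+1}$ whenever $\gamma_i>n-k$, and $t=0$ if no part of $\gamma$ equals $n-k$, $t\in\{1,2\}$ otherwise. -}

module Defs where

open import Data.Nat using (ℕ; zero; suc; _+_; _*_; _∸_; _≤_; _<_; _≡ᵇ_; _<ᵇ_)
open import Data.Bool using (Bool; true; false; if_then_else_; _∧_; _∨_)
open import Data.Integer as ℤ using (ℤ)
open import Data.Product using (Σ; _×_; _,_; ∃)
open import Data.Sum using (_⊎_)
open import Data.Vec using (Vec; tabulate; lookup)
open import Data.Fin using (Fin; toℕ)
open import Relation.Binary.PropositionalEquality using (_≡_)
open import Relation.Nullary using (¬_)

-- Coordinates are indexed 1..n.
-- The triple (a , b , minus) stands for e_a - e_b,
-- the triple (a , b , plus)  stands for e_a + e_b.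
-- The positive roots are those with 1 ≤ a < b ≤ n.

data Sign : Set where
  minus plus : Sign

RootIdx : Set
RootIdx = ℕ × ℕ × Sign

unit : ℕ → ℕ → ℤ
unit a j = if a ≡ᵇ j then ℤ.+ 1 else ℤ.+ 0

rootVec : RootIdx → ℕ → ℤ
rootVec (a , b , minus) j = unit a j ℤ.- unit b j
rootVec (a , b , plus)  j = unit a j ℤ.+ unit b j

simpleRoot : (n i : ℕ) → ℕ → ℤ
simpleRoot n i = if i <ᵇ n then rootVec (i , suc i , minus)
                           else rootVec (n ∸ 1 , n , plus)

sumℤ : ℕ → (ℕ → ℤ) → ℤ
sumℤ zero    f = ℤ.+ 0
sumℤ (suc m) f = sumℤ m f ℤ.+ f (suc m)

sumℕ : ℕ → (ℕ → ℕ) → ℕ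
sumℕ zero    f = 0
sumℕ (suc m) f = sumℕ m f + f (suc m)

anyℕ : ℕ → (ℕ → Bool) → Bool
anyℕ zero    p = false
anyℕ (suc m) p = anyℕ m p ∨ p (suc m)

_≼[_]_ : RootIdx → ℕ → RootIdx → Set
α ≼[ n ] α' = Σ (ℕ → ℕ) λ c → ∀ j → 1 ≤ j → j ≤ n →
  rootVec α' j ℤ.- rootVec α j ≡ sumℤ n (λ i → ℤ.+ (c i) ℤ.* simpleRoot n i j)

InBase : (k n : ℕ) → RootIdx → Set
InBase k n (a , c , s) = 1 ≤ a × a ≤ k × k < c × c ≤ n

InTop : (k : ℕ) → RootIdx → Set
InTop k (a , b , s) = s ≡ plus × 1 ≤ a × a < b × b ≤ k

InΛ : (k n : ℕ) → RootIdx → Set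
InΛ k n α = InBase k n α ⊎ InTop k α

RootSet : Set
RootSet = RootIdx → Bool

LowerIdealIn : (R : RootIdx → Set) → ℕ → RootSet → Set
LowerIdealIn R n S = ∀ α β → R α → R β → S α ≡ true → β ≼[ n ] α → S β ≡ true

bit : Bool → ℕ
bit true  = 1
bit false = 0

dcount : (k n : ℕ) → RootSet → ℕ → ℕ
dcount k n S a = sumℕ n (λ c → if k <ᵇ c
  then bit (S (a , c , minus)) + bit (S (a , c , plus)) else 0)

Θ : (k n : ℕ) → RootSet → Set
Θ k n S =
  (∀ α → S α ≡ true → InΛ k n α) ×
  LowerIdealIn (InBase k n) n S ×
  LowerIdealIn (InTop k) n S ×
  (∀ a b → 1 ≤ a → a < b → b ≤ k →
     (2 * (n ∸ k) < dcount k n S a + dcount k n S b → S (a , b , plus) ≡ true) ×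
     (dcount k n S a + dcount k n S b < 2 * (n ∸ k) → S (a , b , plus) ≡ false))

S¹ : (k n : ℕ) → RootSet → ℕ → ℕ
S¹ k n S i = dcount k n S (suc k ∸ i)

S² : (k : ℕ) → RootSet → ℕ → ℕ
S² k S i = sumℕ (k ∸ i) (λ a → bit (S (a , suc k ∸ i , plus)))

up : (k n : ℕ) → RootSet → Bool
up k n S = anyℕ k (λ i → (S¹ k n S i ≡ᵇ (n ∸ k)) ∧ S (suc k ∸ i , n , minus))

down : (k n : ℕ) → RootSet → Bool
down k n S = anyℕ k (λ i → (S¹ k n S i ≡ᵇ (n ∸ k)) ∧ S (suc k ∸ i , n , plus))

tag : (k n : ℕ) → RootSet → ℕ
tag k n S = if up k n S then 1 else if down k n S then 2 else 0

-- F_k(S) = ((S¹_i + S²_i)_{1≤i≤k} ; t); entry (i : Fin k) of the vector is index toℕ i + 1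
F : (k n : ℕ) → RootSet → Vec ℕ k × ℕ
F k n S = tabulate (λ (i : Fin k) → S¹ k n S (suc (toℕ i)) + S² k S (suc (toℕ i))) , tag k n S

-- P̃(n-k, n): γ a partition with at most k parts (a length-k vector padded with zeros),
-- each part ≤ 2n-1-k, γ_i > γ_{i+1} whenever γ_i > n-k, and t = 0 if no part equals n-k,
-- t ∈ {1,2} otherwise.
P̃ : (k n : ℕ) → Vec ℕ k × ℕ → Set
P̃ k n (γ , t) =
  (∀ (i j : Fin k) → toℕ i ≤ toℕ j → lookup γ j ≤ lookup γ i) ×
  (∀ (i : Fin k) → lookup γ i ≤ 2 * n ∸ 1 ∸ k) ×
  (∀ (i j : Fin k) → toℕ j ≡ suc (toℕ i) → n ∸ k < lookup γ i → lookup γ j < lookup γ i) ×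
  ((¬ (∃ λ (i : Fin k) → lookup γ i ≡ n ∸ k)) → t ≡ 0) ×
  ((∃ λ (i : Fin k) → lookup γ i ≡ n ∸ k) → t ≡ 1 ⊎ t ≡ 2)

-- Write m = n - k.  Row a (1 ≤ a ≤ k) of S is S ∩ {e_a ± e_c : k < c ≤ n}, of size
-- d a = |S ∩ D(a)|; column b of the top region is S ∩ {e_x + e_b : x < b}, of size
-- τ b; the entry of F_k(S) attached to row a is part a = d a + τ a.  As S is a lower
-- ideal, the minus roots of a row form an initial and its plus roots a final segment;
-- when e_a - e_n ∉ S the whole row is an initial segment of one "staircase" of
-- length m; each top column is a final segment.  Such segments are determined by
-- their sizes.

module Submission where

open import Defs
open import Data.Bool using (Bool; true; false; if_then_else_; not; _∧_)
open import Data.Bool.Properties using (not-injective; ∨-zeroʳ; T-≡)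
open import Function.Base using (_∘_)
open import Data.Integer as ℤ using (ℤ)
import Data.Integer.Properties as ℤP
open import Data.Integer.Tactic.RingSolver using (solve-∀)
import Data.Nat.Tactic.RingSolver as ℕ-Ring
open import Data.Nat using (ℕ; zero; suc; _+_; _*_; _∸_; _≤_; _<_; _≡ᵇ_; _<ᵇ_; z≤n; s≤s)
open import Data.Nat.Properties
open import Data.Product using (Σ; _×_; _,_; ∃; proj₁; proj₂)
open import Data.Sum using (_⊎_; inj₁; inj₂; [_,_]′)
open import Data.Fin using (Fin; toℕ; fromℕ<)
open import Data.Fin.Properties using (toℕ<n; toℕ-fromℕ<)
open import Data.Vec using (Vec; lookup)
open import Data.Vec.Properties using (lookup∘tabulate)
open import Function.Bundles using (Equivalence; _⇔_; mk⇔)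
open import Function.Construct.Composition using (_⇔-∘_)
open import Function.Construct.Symmetry using (⇔-sym)
open import Relation.Binary.PropositionalEquality
open import Relation.Nullary using (¬_; Dec; yes; no; contradiction)
open import Relation.Nullary.Decidable using (_×-dec_; map′)
open import Relation.Binary using (tri<; tri≈; tri>)

true≢false : true ≢ false
true≢false ()

<ᵇ-true : ∀ {m n} → m < n → (m <ᵇ n) ≡ true
<ᵇ-true m<n = Equivalence.to T-≡ (<⇒<ᵇ m<n)

<ᵇ-false : ∀ {m n} → n ≤ m → (m <ᵇ n) ≡ false
<ᵇ-false {m} {n} n≤m with m <ᵇ n in eq
... | false = refl
... | true  = contradiction (<ᵇ⇒< m n (Equivalence.from T-≡ eq)) (≤⇒≯ n≤m)

<ᵇ-true⁻¹ : ∀ m n → (m <ᵇ n) ≡ true → m < n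
<ᵇ-true⁻¹ m n eq = <ᵇ⇒< m n (Equivalence.from T-≡ eq)

≡ᵇ-true : ∀ n → (n ≡ᵇ n) ≡ true
≡ᵇ-true n = Equivalence.to T-≡ (≡⇒≡ᵇ n n refl)

≡ᵇ-false : ∀ {m n} → m ≢ n → (m ≡ᵇ n) ≡ false
≡ᵇ-false {m} {n} m≢n with m ≡ᵇ n in eq
... | false = refl
... | true  = contradiction (≡ᵇ⇒≡ m n (Equivalence.from T-≡ eq)) m≢n

≡ᵇ-true⁻¹ : ∀ m n → (m ≡ᵇ n) ≡ true → m ≡ n
≡ᵇ-true⁻¹ m n eq = ≡ᵇ⇒≡ m n (Equivalence.from T-≡ eq)

∧-true : ∀ {a b} → a ∧ b ≡ true → a ≡ true × b ≡ true
∧-true {true} b≡true = refl , b≡true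

bool-ext : ∀ {a b} → (a ≡ true → b ≢ false) → (b ≡ true → a ≢ false) → a ≡ b
bool-ext {false} {false} _   _   = refl
bool-ext {true}  {true}  _   _   = refl
bool-ext {true}  {false} a⇒b _   = contradiction refl (a⇒b refl)
bool-ext {false} {true}  _   b⇒a = contradiction refl (b⇒a refl)

≢true⇒false : ∀ {b} → b ≢ true → b ≡ false
≢true⇒false {false} _     = refl
≢true⇒false {true}  b≢true = contradiction refl b≢true

≢false⇒true : ∀ {b} → b ≢ false → b ≡ true
≢false⇒true {true}  _       = refl
≢false⇒true {false} b≢false = contradiction refl b≢false

by-cases : ∀ {ℓ} {A : Set ℓ} b → (b ≡ true → A) → (b ≡ false → A) → A
by-cases true  if-true _        = if-true refl
by-cases false _       if-false = if-false refl

bit-mono : ∀ {b b′} → (b ≡ true → b′ ≡ true) → bit b ≤ bit b′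
bit-mono {false} _ = z≤n
bit-mono {true}  b⇒b′ rewrite b⇒b′ refl = ≤-refl

sumℕ-cong : ∀ N {f g} → (∀ x → 1 ≤ x → x ≤ N → f x ≡ g x) → sumℕ N f ≡ sumℕ N g
sumℕ-cong zero    f≗g = refl
sumℕ-cong (suc N) f≗g =
  cong₂ _+_ (sumℕ-cong N (λ x 1≤x x≤N → f≗g x 1≤x (m≤n⇒m≤1+n x≤N))) (f≗g (suc N) (s≤s z≤n) ≤-refl)

sumℕ-mono : ∀ N {f g} → (∀ x → 1 ≤ x → x ≤ N → f x ≤ g x) → sumℕ N f ≤ sumℕ N g
sumℕ-mono zero    f≤g = z≤n
sumℕ-mono (suc N) f≤g =
  +-mono-≤ (sumℕ-mono N (λ x 1≤x x≤N → f≤g x 1≤x (m≤n⇒m≤1+n x≤N))) (f≤g (suc N) (s≤s z≤n) ≤-refl)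

sumℕ-+ : ∀ N f g → sumℕ N (λ x → f x + g x) ≡ sumℕ N f + sumℕ N g
sumℕ-+ zero    f g = refl
sumℕ-+ (suc N) f g rewrite sumℕ-+ N f g = interchange (sumℕ N f) (sumℕ N g) (f (suc N)) (g (suc N))
  where
  interchange : ∀ a b c d → a + b + (c + d) ≡ a + c + (b + d)
  interchange = ℕ-Ring.solve-∀

sumℕ-extend : ∀ N N′ f → N ≤ N′ → sumℕ N f ≤ sumℕ N′ f
sumℕ-extend N zero    f z≤n = ≤-refl
sumℕ-extend N (suc N′) f N≤1+N′ with N ≟ suc N′
... | yes refl = ≤-refl
... | no  N≢1+N′ = ≤-trans (sumℕ-extend N N′ f (≤-pred (≤∧≢⇒< N≤1+N′ N≢1+N′))) (m≤m+n _ _)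

-- Counting: count lo N P = #{ x : lo < x ≤ N , P x }.  Rows of a root set are
-- counted this way (lo = k), and so are the columns of the top region (lo = 0).

count : ℕ → ℕ → (ℕ → Bool) → ℕ
count lo N P = sumℕ N (λ x → if lo <ᵇ x then bit (P x) else 0)

count-cong : ∀ lo N {P Q} → (∀ x → lo < x → x ≤ N → P x ≡ Q x) → count lo N P ≡ count lo N Q
count-cong lo N {P} {Q} P≗Q = sumℕ-cong N summand
  where
  summand : ∀ x → 1 ≤ x → x ≤ N → (if lo <ᵇ x then bit (P x) else 0) ≡ (if lo <ᵇ x then bit (Q x) else 0)
  summand x _ x≤N with lo <ᵇ x in lo<ᵇx
  ... | false = refl
  ... | true  = cong bit (P≗Q x (<ᵇ-true⁻¹ lo x lo<ᵇx) x≤N)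

count-mono : ∀ lo N {P Q} → (∀ x → lo < x → x ≤ N → P x ≡ true → Q x ≡ true) →
             count lo N P ≤ count lo N Q
count-mono lo N {P} {Q} P⇒Q = sumℕ-mono N summand
  where
  summand : ∀ x → 1 ≤ x → x ≤ N → (if lo <ᵇ x then bit (P x) else 0) ≤ (if lo <ᵇ x then bit (Q x) else 0)
  summand x _ x≤N with lo <ᵇ x in lo<ᵇx
  ... | false = z≤n
  ... | true  = bit-mono (P⇒Q x (<ᵇ-true⁻¹ lo x lo<ᵇx) x≤N)

count-extend : ∀ lo N N′ P → N ≤ N′ → count lo N P ≤ count lo N′ P
count-extend lo N N′ P = sumℕ-extend N N′ _

count-suc : ∀ lo N P → lo < suc N → count lo (suc N) P ≡ count lo N P + bit (P (suc N))
count-suc lo N P lo<1+N rewrite <ᵇ-true lo<1+N = refl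

count-suc-empty : ∀ lo N P → suc N ≤ lo → count lo (suc N) P ≡ count lo N P
count-suc-empty lo N P 1+N≤lo rewrite <ᵇ-false 1+N≤lo = +-identityʳ _

count-true : ∀ lo N → count lo N (λ _ → true) ≡ N ∸ lo
count-true lo zero = sym (0∸n≡0 lo)
count-true lo (suc N) with lo <? suc N
... | yes lo<1+N = begin
  count lo (suc N) (λ _ → true) ≡⟨ count-suc lo N _ lo<1+N ⟩
  count lo N (λ _ → true) + 1   ≡⟨ cong (_+ 1) (count-true lo N) ⟩
  (N ∸ lo) + 1                  ≡⟨ +-comm (N ∸ lo) 1 ⟩
  1 + (N ∸ lo)                  ≡⟨ sym (+-∸-assoc 1 (≤-pred lo<1+N)) ⟩
  suc N ∸ lo                    ∎
  where open ≡-Reasoning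
... | no lo≮1+N = begin
  count lo (suc N) (λ _ → true) ≡⟨ count-suc-empty lo N _ (≮⇒≥ lo≮1+N) ⟩
  count lo N (λ _ → true)       ≡⟨ count-true lo N ⟩
  N ∸ lo                        ≡⟨ m≤n⇒m∸n≡0 (≤-trans (n≤1+n N) (≮⇒≥ lo≮1+N)) ⟩
  0                             ≡⟨ sym (m≤n⇒m∸n≡0 (≮⇒≥ lo≮1+N)) ⟩
  suc N ∸ lo                    ∎
  where open ≡-Reasoning

count-≤ : ∀ lo N P → count lo N P ≤ N ∸ lo
count-≤ lo N P = ≤-trans (count-mono lo N (λ _ _ _ _ → refl)) (≤-reflexive (count-true lo N))

count-all-true : ∀ lo N P → (∀ x → lo < x → x ≤ N → P x ≡ true) → count lo N P ≡ N ∸ lo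
count-all-true lo N P all = trans (count-cong lo N all) (count-true lo N)

count-complement : ∀ lo N P → count lo N P + count lo N (not ∘ P) ≡ N ∸ lo
count-complement lo N P =
  trans (sym (sumℕ-+ N _ _)) (trans (sumℕ-cong N summand) (count-true lo N))
  where
  bit-not : ∀ b → bit b + bit (not b) ≡ 1
  bit-not true  = refl
  bit-not false = refl
  summand : ∀ x → 1 ≤ x → x ≤ N →
    (if lo <ᵇ x then bit (P x) else 0) + (if lo <ᵇ x then bit (not (P x)) else 0) ≡ (if lo <ᵇ x then 1 else 0)
  summand x _ _ with lo <ᵇ x
  ... | false = refl
  ... | true  = bit-not (P x)

count-all-false : ∀ lo N P → (∀ x → lo < x → x ≤ N → P x ≡ false) → count lo N P ≡ 0
count-all-false lo N P none = +-cancelʳ-≡ (N ∸ lo) (count lo N P) 0 (begin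
  count lo N P + (N ∸ lo)            ≡⟨ cong (count lo N P +_) (sym (count-all-true lo N (not ∘ P) notP)) ⟩
  count lo N P + count lo N (not ∘ P) ≡⟨ count-complement lo N P ⟩
  N ∸ lo                              ∎)
  where
  open ≡-Reasoning
  notP : ∀ x → lo < x → x ≤ N → not (P x) ≡ true
  notP x lo<x x≤N = cong not (none x lo<x x≤N)

count-last-true : ∀ lo N P → lo < N → P N ≡ true → 1 ≤ count lo N P
count-last-true lo (suc N) P lo<1+N PN rewrite count-suc lo N P lo<1+N | PN = m≤n+m 1 _

count-last-false : ∀ lo N P → lo < N → P N ≡ false → count lo N P < N ∸ lo
count-last-false lo N P lo<N PN = begin-strict
  count lo N P                         <⟨ m<m+n (count lo N P) (count-last-true lo N (not ∘ P) lo<N (cong not PN)) ⟩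
  count lo N P + count lo N (not ∘ P) ≡⟨ count-complement lo N P ⟩
  N ∸ lo                              ∎
  where open ≤-Reasoning

UpClosed : ℕ → ℕ → (ℕ → Bool) → Set
UpClosed lo N P = ∀ x y → lo < x → x ≤ y → y ≤ N → P x ≡ true → P y ≡ true

DownClosed : ℕ → ℕ → (ℕ → Bool) → Set
DownClosed lo N P = ∀ x y → lo < x → x ≤ y → y ≤ N → P y ≡ true → P x ≡ true

DownClosed⇒UpClosed-not : ∀ {lo N P} → DownClosed lo N P → UpClosed lo N (not ∘ P)
DownClosed⇒UpClosed-not {P = P} down x y lo<x x≤y y≤N notPx with P y in Py
... | false = refl
... | true  = contradiction (trans (sym (cong not (down x y lo<x x≤y y≤N Py))) notPx) λ ()

up-closed-empty : ∀ lo N {R} → UpClosed lo N R → R N ≡ false → count lo N R ≡ 0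
up-closed-empty lo N {R} upR RN = count-all-false lo N R absent
  where
  absent : ∀ y → lo < y → y ≤ N → R y ≡ false
  absent y lo<y y≤N with R y in Ry
  ... | false = refl
  ... | true  = contradiction (trans (sym (upR y N lo<y y≤N ≤-refl Ry)) RN) true≢false

up-closed-last-differs : ∀ lo N {P Q} → lo < N → UpClosed lo N Q → P N ≡ true → Q N ≡ false →
                         count lo N P ≢ count lo N Q
up-closed-last-differs lo N {P} lo<N upQ PN QN same =
  >⇒≢ (count-last-true lo N P lo<N PN) (trans same (up-closed-empty lo N upQ QN))

up-closed-last-agrees : ∀ lo N {P Q} → lo < N → UpClosed lo N P → UpClosed lo N Q →
  count lo N P ≡ count lo N Q → P N ≡ Q N
up-closed-last-agrees lo N lo<N upP upQ same =
  bool-ext (λ PN QN → up-closed-last-differs lo N lo<N upQ PN QN same)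
           (λ QN PN → up-closed-last-differs lo N lo<N upP QN PN (sym same))

-- An up-closed predicate is a final segment of (lo, N], so it is determined by
-- how many points it contains.
up-closed-count-determines : ∀ lo N {P Q} → UpClosed lo N P → UpClosed lo N Q →
  count lo N P ≡ count lo N Q → ∀ x → lo < x → x ≤ N → P x ≡ Q x
up-closed-count-determines lo zero _ _ _ x lo<x x≤0 = contradiction (<-≤-trans lo<x x≤0) n≮0
up-closed-count-determines lo (suc N) {P} {Q} upP upQ same x lo<x x≤1+N with x ≟ suc N
... | yes refl = up-closed-last-agrees lo (suc N) lo<x upP upQ same
... | no x≢1+N = up-closed-count-determines lo N
  (λ y z lo<y y≤z z≤N → upP y z lo<y y≤z (m≤n⇒m≤1+n z≤N))
  (λ y z lo<y y≤z z≤N → upQ y z lo<y y≤z (m≤n⇒m≤1+n z≤N))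
  same-below x lo<x (≤-pred (≤∧≢⇒< x≤1+N x≢1+N))
  where
  lo<1+N : lo < suc N
  lo<1+N = <-≤-trans lo<x x≤1+N
  last-agrees : P (suc N) ≡ Q (suc N)
  last-agrees = up-closed-last-agrees lo (suc N) lo<1+N upP upQ same
  same-below : count lo N P ≡ count lo N Q
  same-below = +-cancelʳ-≡ (bit (Q (suc N))) _ _ (begin
    count lo N P + bit (Q (suc N)) ≡⟨ cong (λ b → count lo N P + bit b) (sym last-agrees) ⟩
    count lo N P + bit (P (suc N)) ≡⟨ sym (count-suc lo N P lo<1+N) ⟩
    count lo (suc N) P             ≡⟨ same ⟩
    count lo (suc N) Q             ≡⟨ count-suc lo N Q lo<1+N ⟩
    count lo N Q + bit (Q (suc N)) ∎)
    where open ≡-Reasoning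

-- Dually for down-closed predicates (initial segments), via complements.
down-closed-count-determines : ∀ lo N {P Q} → DownClosed lo N P → DownClosed lo N Q →
  count lo N P ≡ count lo N Q → ∀ x → lo < x → x ≤ N → P x ≡ Q x
down-closed-count-determines lo N {P} {Q} downP downQ same x lo<x x≤N =
  not-injective (up-closed-count-determines lo N
    (DownClosed⇒UpClosed-not downP) (DownClosed⇒UpClosed-not downQ) same-complement x lo<x x≤N)
  where
  same-complement : count lo N (not ∘ P) ≡ count lo N (not ∘ Q)
  same-complement = +-cancelˡ-≡ (count lo N P) _ _ (begin
    count lo N P + count lo N (not ∘ P) ≡⟨ count-complement lo N P ⟩
    N ∸ lo                              ≡⟨ sym (count-complement lo N Q) ⟩
    count lo N Q + count lo N (not ∘ Q) ≡⟨ cong (_+ count lo N (not ∘ Q)) (sym same) ⟩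
    count lo N P + count lo N (not ∘ Q) ∎)
    where open ≡-Reasoning

-- The root order.  α ≼[ n ] β says that β - α lies in the cone of nonnegative
-- integer combinations of the simple roots; we show that the vectors e_x - e_y
-- (x < y) and e_x + e_n lie in this cone, which yields all comparisons used below.

InCone : ℕ → (ℕ → ℤ) → Set
InCone n v = Σ (ℕ → ℕ) λ c → ∀ j → 1 ≤ j → j ≤ n → v j ≡ sumℤ n (λ i → ℤ.+ (c i) ℤ.* simpleRoot n i j)

sumℤ-cong : ∀ N {f g : ℕ → ℤ} → (∀ i → f i ≡ g i) → sumℤ N f ≡ sumℤ N g
sumℤ-cong zero    f≗g = refl
sumℤ-cong (suc N) f≗g = cong₂ ℤ._+_ (sumℤ-cong N f≗g) (f≗g (suc N))

sumℤ-+ : ∀ N (f g : ℕ → ℤ) → sumℤ N (λ i → f i ℤ.+ g i) ≡ sumℤ N f ℤ.+ sumℤ N g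
sumℤ-+ zero    f g = refl
sumℤ-+ (suc N) f g =
  trans (cong (ℤ._+ (f (suc N) ℤ.+ g (suc N))) (sumℤ-+ N f g)) (shuffle (sumℤ N f) (sumℤ N g) (f (suc N)) (g (suc N)))
  where
  shuffle : ∀ (a b c d : ℤ) → (a ℤ.+ b) ℤ.+ (c ℤ.+ d) ≡ (a ℤ.+ c) ℤ.+ (b ℤ.+ d)
  shuffle = solve-∀

cone-cong : ∀ n {v w} → (∀ j → 1 ≤ j → j ≤ n → v j ≡ w j) → InCone n v → InCone n w
cone-cong n v≗w (c , v≡) = c , λ j 1≤j j≤n → trans (sym (v≗w j 1≤j j≤n)) (v≡ j 1≤j j≤n)

cone-+ : ∀ n {v w} → InCone n v → InCone n w → InCone n (λ j → v j ℤ.+ w j)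
cone-+ n (c , v≡) (c′ , w≡) = (λ i → c i + c′ i) , λ j 1≤j j≤n →
  trans (cong₂ ℤ._+_ (v≡ j 1≤j j≤n) (w≡ j 1≤j j≤n)) (sym (trans
    (sumℤ-cong n (λ i → trans (cong (ℤ._* simpleRoot n i j) (ℤP.pos-+ (c i) (c′ i)))
                              (ℤP.*-distribʳ-+ (simpleRoot n i j) (ℤ.+ c i) (ℤ.+ c′ i))))
    (sumℤ-+ n _ _)))

indicator : ℕ → ℕ → ℕ
indicator p i = if i ≡ᵇ p then 1 else 0

sumℤ-indicator-beyond : ∀ N p (f : ℕ → ℤ) → N < p → sumℤ N (λ i → ℤ.+ (indicator p i) ℤ.* f i) ≡ ℤ.+ 0
sumℤ-indicator-beyond zero    p f N<p = refl
sumℤ-indicator-beyond (suc N) p f N<p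
  rewrite ≡ᵇ-false {suc N} {p} (<⇒≢ N<p) | sumℤ-indicator-beyond N p f (<-trans (n<1+n N) N<p) =
  ℤP.*-zeroˡ (f (suc N))

sumℤ-indicator : ∀ N p (f : ℕ → ℤ) → 1 ≤ p → p ≤ N → sumℤ N (λ i → ℤ.+ (indicator p i) ℤ.* f i) ≡ f p
sumℤ-indicator zero    p f 1≤p p≤0 = contradiction (≤-trans 1≤p p≤0) (λ ())
sumℤ-indicator (suc N) p f 1≤p p≤1+N with suc N ≟ p
... | yes refl rewrite ≡ᵇ-true (suc N) | sumℤ-indicator-beyond N (suc N) f ≤-refl =
  trans (ℤP.+-identityˡ _) (ℤP.*-identityˡ (f (suc N)))
... | no 1+N≢p rewrite ≡ᵇ-false 1+N≢p | sumℤ-indicator N p f 1≤p (≤-pred (≤∧≢⇒< p≤1+N (1+N≢p ∘ sym))) =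
  trans (cong (λ z → f p ℤ.+ z) (ℤP.*-zeroˡ (f (suc N)))) (ℤP.+-identityʳ (f p))

cone-simple : ∀ n p → 1 ≤ p → p ≤ n → InCone n (simpleRoot n p)
cone-simple n p 1≤p p≤n = indicator p , λ j _ _ → sym (sumℤ-indicator n p (λ i → simpleRoot n i j) 1≤p p≤n)

simpleRoot-short : ∀ n x j → x < n → simpleRoot n x j ≡ unit x j ℤ.- unit (suc x) j
simpleRoot-short n x j x<n rewrite <ᵇ-true x<n = refl

simpleRoot-last : ∀ n j → simpleRoot (suc n) (suc n) j ≡ unit n j ℤ.+ unit (suc n) j
simpleRoot-last n j rewrite <ᵇ-false {suc n} {suc n} ≤-refl = refl

-- e_x - e_y = α_x + α_{x+1} + ... + α_{y-1}.
cone-minus : ∀ n x y → 1 ≤ x → x < y → y ≤ n → InCone n (λ j → unit x j ℤ.- unit y j)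
cone-minus n x (suc y) 1≤x (s≤s x≤y) y<n with x ≟ y
... | yes refl = cone-cong n (λ j _ _ → simpleRoot-short n x j y<n) (cone-simple n x 1≤x (<⇒≤ y<n))
... | no x≢y = cone-cong n (λ j _ _ → telescope j)
  (cone-+ n (cone-minus n x y 1≤x (≤∧≢⇒< x≤y x≢y) (<⇒≤ y<n)) (cone-simple n y (≤-trans 1≤x x≤y) (<⇒≤ y<n)))
  where
  telescope : ∀ j → (unit x j ℤ.- unit y j) ℤ.+ simpleRoot n y j ≡ unit x j ℤ.- unit (suc y) j
  telescope j = trans (cong (λ z → (unit x j ℤ.- unit y j) ℤ.+ z) (simpleRoot-short n y j y<n))
                      (cancel (unit x j) (unit y j) (unit (suc y) j))
    where
    cancel : ∀ (a b c : ℤ) → (a ℤ.- b) ℤ.+ (b ℤ.- c) ≡ a ℤ.- c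
    cancel = solve-∀

-- e_x + e_n = (e_x - e_{n-1}) + α_n.
cone-plus-last : ∀ n x → 1 ≤ x → x < n → InCone n (λ j → unit x j ℤ.+ unit n j)
cone-plus-last (suc n) x 1≤x (s≤s x≤n) with x ≟ n
... | yes refl = cone-cong (suc n) (λ j _ _ → simpleRoot-last x j) (cone-simple (suc n) (suc x) (s≤s z≤n) ≤-refl)
... | no x≢n = cone-cong (suc n) (λ j _ _ → telescope j)
  (cone-+ (suc n) (cone-minus (suc n) x n 1≤x (≤∧≢⇒< x≤n x≢n) (n≤1+n n)) (cone-simple (suc n) (suc n) (s≤s z≤n) ≤-refl))
  where
  telescope : ∀ j → (unit x j ℤ.- unit n j) ℤ.+ simpleRoot (suc n) (suc n) j ≡ unit x j ℤ.+ unit (suc n) j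
  telescope j = trans (cong (λ z → (unit x j ℤ.- unit n j) ℤ.+ z) (simpleRoot-last n j))
                      (cancel (unit x j) (unit n j) (unit (suc n) j))
    where
    cancel : ∀ (a b c : ℤ) → (a ℤ.- b) ℤ.+ (b ℤ.+ c) ≡ a ℤ.+ c
    cancel = solve-∀

≼-intro : ∀ n α β {v} → (∀ j → rootVec β j ℤ.- rootVec α j ≡ v j) → InCone n v → α ≼[ n ] β
≼-intro n α β β-α≡v = cone-cong n (λ j _ _ → sym (β-α≡v j))

minus-≼-minus : ∀ n a c c′ → 1 ≤ c → c < c′ → c′ ≤ n → (a , c , minus) ≼[ n ] (a , c′ , minus)
minus-≼-minus n a c c′ 1≤c c<c′ c′≤n =
  ≼-intro n (a , c , minus) (a , c′ , minus) (λ j → difference (unit a j) (unit c j) (unit c′ j))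
    (cone-minus n c c′ 1≤c c<c′ c′≤n)
  where
  difference : ∀ (x y z : ℤ) → (x ℤ.- z) ℤ.- (x ℤ.- y) ≡ y ℤ.- z
  difference = solve-∀

plus-≼-plus : ∀ n a c c′ → 1 ≤ c → c < c′ → c′ ≤ n → (a , c′ , plus) ≼[ n ] (a , c , plus)
plus-≼-plus n a c c′ 1≤c c<c′ c′≤n =
  ≼-intro n (a , c′ , plus) (a , c , plus) (λ j → difference (unit a j) (unit c j) (unit c′ j))
    (cone-minus n c c′ 1≤c c<c′ c′≤n)
  where
  difference : ∀ (x y z : ℤ) → (x ℤ.+ y) ℤ.- (x ℤ.+ z) ≡ y ℤ.- z
  difference = solve-∀

minus-last-≼-plus : ∀ n a c → 1 ≤ c → c < n → (a , n , minus) ≼[ n ] (a , c , plus)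
minus-last-≼-plus n a c 1≤c c<n =
  ≼-intro n (a , n , minus) (a , c , plus) (λ j → difference (unit a j) (unit c j) (unit n j))
    (cone-plus-last n c 1≤c c<n)
  where
  difference : ∀ (x y z : ℤ) → (x ℤ.+ y) ℤ.- (x ℤ.- z) ≡ y ℤ.+ z
  difference = solve-∀

minus-≼-plus-last : ∀ n a c → 1 ≤ c → c < n → (a , c , minus) ≼[ n ] (a , n , plus)
minus-≼-plus-last n a c 1≤c c<n =
  ≼-intro n (a , c , minus) (a , n , plus) (λ j → difference (unit a j) (unit c j) (unit n j))
    (cone-plus-last n c 1≤c c<n)
  where
  difference : ∀ (x y z : ℤ) → (x ℤ.+ z) ℤ.- (x ℤ.- y) ≡ y ℤ.+ z
  difference = solve-∀

lower-row-≼ : ∀ n a a′ c s → 1 ≤ a → a < a′ → a′ ≤ n → (a′ , c , s) ≼[ n ] (a , c , s)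
lower-row-≼ n a a′ c minus 1≤a a<a′ a′≤n =
  ≼-intro n (a′ , c , minus) (a , c , minus) (λ j → difference (unit a j) (unit a′ j) (unit c j))
    (cone-minus n a a′ 1≤a a<a′ a′≤n)
  where
  difference : ∀ (x y z : ℤ) → (x ℤ.- z) ℤ.- (y ℤ.- z) ≡ x ℤ.- y
  difference = solve-∀
lower-row-≼ n a a′ c plus 1≤a a<a′ a′≤n =
  ≼-intro n (a′ , c , plus) (a , c , plus) (λ j → difference (unit a j) (unit a′ j) (unit c j))
    (cone-minus n a a′ 1≤a a<a′ a′≤n)
  where
  difference : ∀ (x y z : ℤ) → (x ℤ.+ z) ℤ.- (y ℤ.+ z) ≡ x ℤ.- y
  difference = solve-∀

anyℕ-intro : ∀ N p i → 1 ≤ i → i ≤ N → p i ≡ true → anyℕ N p ≡ true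
anyℕ-intro zero    p i 1≤i i≤0 _ = contradiction (≤-trans 1≤i i≤0) (λ ())
anyℕ-intro (suc N) p i 1≤i i≤1+N pi with i ≟ suc N
... | yes refl rewrite pi = ∨-zeroʳ (anyℕ N p)
... | no i≢1+N rewrite anyℕ-intro N p i 1≤i (≤-pred (≤∧≢⇒< i≤1+N i≢1+N)) pi = refl

anyℕ-none : ∀ N p → (∀ i → 1 ≤ i → i ≤ N → p i ≡ false) → anyℕ N p ≡ false
anyℕ-none zero    p none = refl
anyℕ-none (suc N) p none rewrite anyℕ-none N p (λ i 1≤i i≤N → none i 1≤i (m≤n⇒m≤1+n i≤N)) =
  none (suc N) (s≤s z≤n) ≤-refl

-- Defs indexes rows a ∈ [1, k] in reverse, by i = k + 1 - a.

flip-row : ∀ k i → 1 ≤ i → i ≤ k → 1 ≤ suc k ∸ i × suc k ∸ i ≤ k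
flip-row k (suc i) _ i<k = m<n⇒0<n∸m i<k , m∸n≤m k i

anyRow-intro : ∀ k (q : ℕ → Bool) a → 1 ≤ a → a ≤ k → q a ≡ true → anyℕ k (λ i → q (suc k ∸ i)) ≡ true
anyRow-intro k q a 1≤a a≤k qa =
  anyℕ-intro k (λ i → q (suc k ∸ i)) (suc k ∸ a) (proj₁ flipped) (proj₂ flipped) (subst (λ b → q b ≡ true) (sym a-back) qa)
  where
  flipped : 1 ≤ suc k ∸ a × suc k ∸ a ≤ k
  flipped = flip-row k a 1≤a a≤k
  a-back : suc k ∸ (suc k ∸ a) ≡ a
  a-back = m∸[m∸n]≡n (m≤n⇒m≤1+n a≤k)

anyRow-none : ∀ k (q : ℕ → Bool) → (∀ a → 1 ≤ a → a ≤ k → q a ≡ false) → anyℕ k (λ i → q (suc k ∸ i)) ≡ false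
anyRow-none k q none = anyℕ-none k (λ i → q (suc k ∸ i)) λ i 1≤i i≤k →
  let (1≤a , a≤k) = flip-row k i 1≤i i≤k in none _ 1≤a a≤k

-- The entry i : Fin k of F_k(S) belongs to the row a = k - i.

row-of : ∀ {k} (i : Fin k) → 1 ≤ k ∸ toℕ i × k ∸ toℕ i ≤ k
row-of {k} i = m<n⇒0<n∸m (toℕ<n i) , m∸n≤m k (toℕ i)

row-above : ∀ {k} (i : Fin k) → suc (k ∸ suc (toℕ i)) ≡ k ∸ toℕ i
row-above i = sym (+-∸-assoc 1 (toℕ<n i))

fin-of-row : ∀ k a → 1 ≤ a → a ≤ k → ∃ λ (i : Fin k) → k ∸ toℕ i ≡ a
fin-of-row (suc k) (suc a) _ a<1+k = fromℕ< k∸a<1+k , trans (cong (suc k ∸_) (toℕ-fromℕ< k∸a<1+k)) (m∸[m∸n]≡n a<1+k)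
  where
  k∸a<1+k : k ∸ a < suc k
  k∸a<1+k = s≤s (m∸n≤m k a)

inBase? : ∀ k n α → Dec (InBase k n α)
inBase? k n (a , c , s) = (1 ≤? a) ×-dec (a ≤? k) ×-dec (k <? c) ×-dec (c ≤? n)

inTop? : ∀ k α → Dec (InTop k α)
inTop? k (a , b , minus) = no λ ()
inTop? k (a , b , plus)  = map′ (refl ,_) proj₂ ((1 ≤? a) ×-dec (a <? b) ×-dec (b ≤? k))

1≤-of-< : ∀ {x y} → x < y → 1 ≤ y
1≤-of-< x<y = ≤-trans (s≤s z≤n) x<y

≤-half : ∀ {x y m} → x ≤ y → x + y ≤ 2 * m → x ≤ m
≤-half {x} {y} {m} x≤y x+y≤2m = ≮⇒≥ λ m<x →
  <⇒≱ (+-mono-<-≤ m<x (<⇒≤ (<-≤-trans m<x x≤y))) (≤-trans x+y≤2m (≤-reflexive (cong (m +_) (+-identityʳ m))))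

module Staircase (k n : ℕ) (k<n : k < n) (S : RootSet) (θ : Θ k n S) where

  m : ℕ
  m = n ∸ k

  inside : ∀ α → S α ≡ true → InΛ k n α
  inside = proj₁ θ

  base-ideal : LowerIdealIn (InBase k n) n S
  base-ideal = proj₁ (proj₂ θ)

  top-ideal : LowerIdealIn (InTop k) n S
  top-ideal = proj₁ (proj₂ (proj₂ θ))

  mn pl : ℕ → ℕ → Bool
  mn a c = S (a , c , minus)
  pl a c = S (a , c , plus)

  d : ℕ → ℕ
  d = dcount k n S

  above-threshold : ∀ a b → 1 ≤ a → a < b → b ≤ k → 2 * m < d a + d b → pl a b ≡ true
  above-threshold a b 1≤a a<b b≤k = proj₁ (proj₂ (proj₂ (proj₂ θ)) a b 1≤a a<b b≤k)

  below-threshold : ∀ a b → 1 ≤ a → a < b → b ≤ k → d a + d b < 2 * m → pl a b ≡ false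
  below-threshold a b 1≤a a<b b≤k = proj₂ (proj₂ (proj₂ (proj₂ θ)) a b 1≤a a<b b≤k)

  in-top⇒sum≥ : ∀ a b → 1 ≤ a → a < b → b ≤ k → pl a b ≡ true → 2 * m ≤ d a + d b
  in-top⇒sum≥ a b 1≤a a<b b≤k in-top = ≮⇒≥ λ below →
    true≢false (trans (sym in-top) (below-threshold a b 1≤a a<b b≤k below))

  not-in-top⇒sum≤ : ∀ a b → 1 ≤ a → a < b → b ≤ k → pl a b ≡ false → d a + d b ≤ 2 * m
  not-in-top⇒sum≤ a b 1≤a a<b b≤k not-in-top = ≮⇒≥ λ above →
    true≢false (trans (sym (above-threshold a b 1≤a a<b b≤k above)) not-in-top)

  absent-outside : ∀ α → ¬ InBase k n α → ¬ InTop k α → S α ≡ false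
  absent-outside α ¬base ¬top = ≢true⇒false λ Sα → [ ¬base , ¬top ]′ (inside α Sα)

  minus-down : ∀ a → 1 ≤ a → a ≤ k → DownClosed k n (mn a)
  minus-down a 1≤a a≤k x y k<x x≤y y≤n mn-ay with x ≟ y
  ... | yes refl = mn-ay
  ... | no x≢y = base-ideal (a , y , minus) (a , x , minus)
    (1≤a , a≤k , <-≤-trans k<x x≤y , y≤n) (1≤a , a≤k , k<x , ≤-trans x≤y y≤n) mn-ay
    (minus-≼-minus n a x y (1≤-of-< k<x) (≤∧≢⇒< x≤y x≢y) y≤n)

  plus-up : ∀ a → 1 ≤ a → a ≤ k → UpClosed k n (pl a)
  plus-up a 1≤a a≤k x y k<x x≤y y≤n pl-ax with x ≟ y
  ... | yes refl = pl-ax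
  ... | no x≢y = base-ideal (a , x , plus) (a , y , plus)
    (1≤a , a≤k , k<x , ≤-trans x≤y y≤n) (1≤a , a≤k , <-≤-trans k<x x≤y , y≤n) pl-ax
    (plus-≼-plus n a x y (1≤-of-< k<x) (≤∧≢⇒< x≤y x≢y) y≤n)

  plus-absent : ∀ a c → 1 ≤ a → a ≤ k → k < c → c < n → mn a n ≡ false → pl a c ≡ false
  plus-absent a c 1≤a a≤k k<c c<n mn-an = ≢true⇒false λ pl-ac → true≢false (trans (sym
    (base-ideal (a , c , plus) (a , n , minus) (1≤a , a≤k , k<c , <⇒≤ c<n) (1≤a , a≤k , k<n , ≤-refl) pl-ac
      (minus-last-≼-plus n a c (1≤-of-< k<c) c<n))) mn-an)

  plus-last-fills-minus : ∀ a c → 1 ≤ a → a ≤ k → k < c → c < n → pl a n ≡ true → mn a c ≡ true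
  plus-last-fills-minus a c 1≤a a≤k k<c c<n pl-an =
    base-ideal (a , n , plus) (a , c , minus) (1≤a , a≤k , k<n , ≤-refl) (1≤a , a≤k , k<c , <⇒≤ c<n) pl-an
      (minus-≼-plus-last n a c (1≤-of-< k<c) c<n)

  lower-row-contains : ∀ a a′ s → 1 ≤ a → a ≤ a′ → a′ ≤ k → ∀ c → k < c → c ≤ n →
                       S (a , c , s) ≡ true → S (a′ , c , s) ≡ true
  lower-row-contains a a′ s 1≤a a≤a′ a′≤k c k<c c≤n S-acs with a ≟ a′
  ... | yes refl = S-acs
  ... | no a≢a′ = base-ideal (a , c , s) (a′ , c , s)
    (1≤a , ≤-trans a≤a′ a′≤k , k<c , c≤n) (≤-trans 1≤a a≤a′ , a′≤k , k<c , c≤n) S-acs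
    (lower-row-≼ n a a′ c s 1≤a (≤∧≢⇒< a≤a′ a≢a′) (≤-trans a′≤k (<⇒≤ k<n)))

  -- When e_a - e_n ∉ S the row holds no plus root except
  -- possibly e_a + e_n, so it is a single initial segment of the "staircase"
  -- e_a - e_{k+1}, ..., e_a - e_{n-1}, e_a + e_n of length m.

  d-split : ∀ a → d a ≡ count k n (mn a) + count k n (pl a)
  d-split a = trans (sumℕ-cong n (λ c _ _ → summand c)) (sumℕ-+ n _ _)
    where
    summand : ∀ c → (if k <ᵇ c then bit (mn a c) + bit (pl a c) else 0) ≡
                    (if k <ᵇ c then bit (mn a c) else 0) + (if k <ᵇ c then bit (pl a c) else 0)
    summand c with k <ᵇ c
    ... | true  = refl
    ... | false = refl

  staircase : ℕ → ℕ → Bool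
  staircase a c = if c <ᵇ n then mn a c else pl a c

  staircase-minus : ∀ a c → c < n → staircase a c ≡ mn a c
  staircase-minus a c c<n rewrite <ᵇ-true c<n = refl

  staircase-last : ∀ a → staircase a n ≡ pl a n
  staircase-last a rewrite <ᵇ-false {n} {n} ≤-refl = refl

  d-staircase : ∀ a → 1 ≤ a → a ≤ k → mn a n ≡ false → d a ≡ count k n (staircase a)
  d-staircase a 1≤a a≤k mn-an = sumℕ-cong n summand
    where
    summand : ∀ c → 1 ≤ c → c ≤ n →
              (if k <ᵇ c then bit (mn a c) + bit (pl a c) else 0) ≡ (if k <ᵇ c then bit (staircase a c) else 0)
    summand c _ c≤n with k <ᵇ c in k<ᵇc | c <? n
    ... | false | _ = refl
    ... | true | yes c<n rewrite staircase-minus a c c<n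
                               | plus-absent a c 1≤a a≤k (<ᵇ-true⁻¹ k c k<ᵇc) c<n mn-an = +-identityʳ _
    ... | true | no c≮n with ≤-antisym c≤n (≮⇒≥ c≮n)
    ...   | refl rewrite staircase-last a | mn-an = refl

  staircase-down : ∀ a → 1 ≤ a → a ≤ k → mn a n ≡ false → DownClosed k n (staircase a)
  staircase-down a 1≤a a≤k mn-an x y k<x x≤y y≤n st-y with x <? n | y <? n
  ... | yes x<n | yes y<n = subst (_≡ true) (sym (staircase-minus a x x<n))
    (minus-down a 1≤a a≤k x y k<x x≤y y≤n (trans (sym (staircase-minus a y y<n)) st-y))
  ... | yes x<n | no y≮n rewrite ≤-antisym y≤n (≮⇒≥ y≮n) = subst (_≡ true) (sym (staircase-minus a x x<n))
    (plus-last-fills-minus a x 1≤a a≤k k<x x<n (trans (sym (staircase-last a)) st-y))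
  ... | no x≮n | yes y<n = contradiction (<-≤-trans y<n (≮⇒≥ x≮n)) (≤⇒≯ x≤y)
  ... | no x≮n | no y≮n rewrite ≤-antisym (≤-trans x≤y y≤n) (≮⇒≥ x≮n) | ≤-antisym y≤n (≮⇒≥ y≮n) = st-y

  minus-full : ∀ a → 1 ≤ a → a ≤ k → mn a n ≡ true → count k n (mn a) ≡ m
  minus-full a 1≤a a≤k mn-an =
    count-all-true k n (mn a) (λ c k<c c≤n → minus-down a 1≤a a≤k c n k<c c≤n ≤-refl mn-an)

  m≤d : ∀ a → 1 ≤ a → a ≤ k → mn a n ≡ true → m ≤ d a
  m≤d a 1≤a a≤k mn-an = ≤-trans (≤-reflexive (sym (minus-full a 1≤a a≤k mn-an)))
    (≤-trans (m≤m+n _ _) (≤-reflexive (sym (d-split a))))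

  m<d : ∀ a → 1 ≤ a → a ≤ k → mn a n ≡ true → pl a n ≡ true → m < d a
  m<d a 1≤a a≤k mn-an pl-an = begin-strict
    m                                 <⟨ m<m+n m (count-last-true k n (pl a) k<n pl-an) ⟩
    m + count k n (pl a)              ≡⟨ cong (_+ count k n (pl a)) (sym (minus-full a 1≤a a≤k mn-an)) ⟩
    count k n (mn a) + count k n (pl a) ≡⟨ sym (d-split a) ⟩
    d a                               ∎
    where open ≤-Reasoning

  d≤m : ∀ a → 1 ≤ a → a ≤ k → mn a n ≡ false → d a ≤ m
  d≤m a 1≤a a≤k mn-an = ≤-trans (≤-reflexive (d-staircase a 1≤a a≤k mn-an)) (count-≤ k n (staircase a))

  d<m : ∀ a → 1 ≤ a → a ≤ k → mn a n ≡ false → pl a n ≡ false → d a < m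
  d<m a 1≤a a≤k mn-an pl-an = subst (_< m) (sym (d-staircase a 1≤a a≤k mn-an))
    (count-last-false k n (staircase a) k<n (trans (staircase-last a) pl-an))

  d≤2m : ∀ a → d a ≤ 2 * m
  d≤2m a = begin
    d a                                 ≡⟨ d-split a ⟩
    count k n (mn a) + count k n (pl a) ≤⟨ +-mono-≤ (count-≤ k n (mn a)) (count-≤ k n (pl a)) ⟩
    m + m                               ≡⟨ cong (m +_) (sym (+-identityʳ m)) ⟩
    2 * m                               ∎
    where open ≤-Reasoning

  d-mono : ∀ a a′ → 1 ≤ a → a ≤ a′ → a′ ≤ k → d a ≤ d a′
  d-mono a a′ 1≤a a≤a′ a′≤k = begin
    d a                                   ≡⟨ d-split a ⟩
    count k n (mn a) + count k n (pl a)   ≤⟨ +-mono-≤ (count-mono k n (lower-row-contains a a′ minus 1≤a a≤a′ a′≤k))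
                                                      (count-mono k n (lower-row-contains a a′ plus 1≤a a≤a′ a′≤k)) ⟩
    count k n (mn a′) + count k n (pl a′) ≡⟨ sym (d-split a′) ⟩
    d a′                                  ∎
    where open ≤-Reasoning

  critical-minus⇒¬plus : ∀ a → 1 ≤ a → a ≤ k → d a ≡ m → mn a n ≡ true → pl a n ≡ false
  critical-minus⇒¬plus a 1≤a a≤k d≡m mn-an = ≢true⇒false λ pl-an → <⇒≢ (m<d a 1≤a a≤k mn-an pl-an) (sym d≡m)

  critical-¬minus⇒plus : ∀ a → 1 ≤ a → a ≤ k → d a ≡ m → mn a n ≡ false → pl a n ≡ true
  critical-¬minus⇒plus a 1≤a a≤k d≡m mn-an = ≢false⇒true λ pl-an → <⇒≢ (d<m a 1≤a a≤k mn-an pl-an) d≡m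

  -- All critical rows make the same choice, which is what makes the tag of F_k well defined.
  critical-rows-agree< : ∀ a b → 1 ≤ a → a < b → b ≤ k → d a ≡ m → d b ≡ m → mn a n ≡ mn b n
  critical-rows-agree< a b 1≤a a<b b≤k da≡m db≡m = bool-ext
    (λ mn-an mn-bn → true≢false (trans (sym (lower-row-contains a b minus 1≤a (<⇒≤ a<b) b≤k n k<n ≤-refl mn-an)) mn-bn))
    (λ mn-bn mn-an → true≢false (trans (sym
      (lower-row-contains a b plus 1≤a (<⇒≤ a<b) b≤k n k<n ≤-refl (critical-¬minus⇒plus a 1≤a a≤k da≡m mn-an)))
      (critical-minus⇒¬plus b 1≤b b≤k db≡m mn-bn)))
    where
    a≤k : a ≤ k
    a≤k = ≤-trans (<⇒≤ a<b) b≤k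
    1≤b : 1 ≤ b
    1≤b = ≤-trans 1≤a (<⇒≤ a<b)

  critical-rows-agree : ∀ a b → 1 ≤ a → a ≤ k → 1 ≤ b → b ≤ k → d a ≡ m → d b ≡ m → mn a n ≡ mn b n
  critical-rows-agree a b 1≤a a≤k 1≤b b≤k da≡m db≡m with <-cmp a b
  ... | tri< a<b _ _ = critical-rows-agree< a b 1≤a a<b b≤k da≡m db≡m
  ... | tri≈ _ refl _ = refl
  ... | tri> _ _ b<a = sym (critical-rows-agree< b a 1≤b b<a a≤k db≡m da≡m)

  top-row-up : ∀ x x′ b → 1 ≤ x → x < x′ → x′ < b → b ≤ k → pl x b ≡ true → pl x′ b ≡ true
  top-row-up x x′ b 1≤x x<x′ x′<b b≤k pl-xb = top-ideal (x , b , plus) (x′ , b , plus)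
    (refl , 1≤x , <-trans x<x′ x′<b , b≤k) (refl , ≤-trans 1≤x (<⇒≤ x<x′) , x′<b , b≤k) pl-xb
    (lower-row-≼ n x x′ b plus 1≤x x<x′ (≤-trans (<⇒≤ x′<b) (≤-trans b≤k (<⇒≤ k<n))))

  top-col-up : ∀ x b b′ → 1 ≤ x → x < b → b < b′ → b′ ≤ k → pl x b ≡ true → pl x b′ ≡ true
  top-col-up x b b′ 1≤x x<b b<b′ b′≤k pl-xb = top-ideal (x , b , plus) (x , b′ , plus)
    (refl , 1≤x , x<b , ≤-trans (<⇒≤ b<b′) b′≤k) (refl , 1≤x , <-trans x<b b<b′ , b′≤k) pl-xb
    (plus-≼-plus n x b b′ (≤-trans 1≤x (<⇒≤ x<b)) b<b′ (≤-trans b′≤k (<⇒≤ k<n)))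

  τ : ℕ → ℕ
  τ zero    = 0
  τ (suc r) = count 0 r (λ x → pl x (suc r))

  column-up : ∀ r → suc r ≤ k → UpClosed 0 r (λ x → pl x (suc r))
  column-up r 1+r≤k x y 0<x x≤y y≤r pl-x with x ≟ y
  ... | yes refl = pl-x
  ... | no x≢y = top-row-up x y (suc r) 0<x (≤∧≢⇒< x≤y x≢y) (s≤s y≤r) 1+r≤k pl-x

  τ≤ : ∀ r → τ (suc r) ≤ r
  τ≤ r = count-≤ 0 r (λ x → pl x (suc r))

  τ-mono : ∀ a a′ → a ≤ a′ → a′ ≤ k → τ a ≤ τ a′
  τ-mono zero    a′       _          _       = z≤n
  τ-mono (suc r) (suc r′) (s≤s r≤r′) 1+r′≤k with r ≟ r′
  ... | yes refl = ≤-refl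
  ... | no r≢r′ = ≤-trans
    (count-mono 0 r (λ x 0<x x≤r → top-col-up x (suc r) (suc r′) 0<x (s≤s x≤r) (s≤s (≤∧≢⇒< r≤r′ r≢r′)) 1+r′≤k))
    (count-extend 0 r r′ _ r≤r′)

  τ-vanishes : ∀ a → 1 ≤ a → suc a ≤ k → pl a (suc a) ≡ false → τ a ≡ 0 × τ (suc a) ≡ 0
  τ-vanishes (suc r) _ 2+r≤k pl-a = count-all-false 0 r _ column-a , count-all-false 0 (suc r) _ column-a+1
    where
    column-a+1 : ∀ x → 0 < x → x ≤ suc r → pl x (suc (suc r)) ≡ false
    column-a+1 x 0<x x≤1+r with x ≟ suc r
    ... | yes refl = pl-a
    ... | no x≢1+r = ≢true⇒false λ pl-x → true≢false (trans
      (sym (top-row-up x (suc r) (suc (suc r)) 0<x (≤∧≢⇒< x≤1+r x≢1+r) ≤-refl 2+r≤k pl-x)) pl-a)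
    column-a : ∀ x → 0 < x → x ≤ r → pl x (suc r) ≡ false
    column-a x 0<x x≤r = ≢true⇒false λ pl-x → true≢false (trans
      (sym (top-col-up x (suc r) (suc (suc r)) 0<x (s≤s x≤r) ≤-refl 2+r≤k pl-x)) (column-a+1 x 0<x (m≤n⇒m≤1+n x≤r)))

  τ-step : ∀ a → 1 ≤ a → suc a ≤ k → pl a (suc a) ≡ true → suc (τ a) ≤ τ (suc a)
  τ-step (suc r) _ 2+r≤k pl-a = begin
    suc (τ (suc r))                          ≡⟨ +-comm 1 _ ⟩
    count 0 r (λ x → pl x (suc r)) + 1       ≤⟨ +-monoˡ-≤ 1 (count-mono 0 r λ x 0<x x≤r →
                                                 top-col-up x (suc r) (suc (suc r)) 0<x (s≤s x≤r) ≤-refl 2+r≤k) ⟩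
    count 0 r (λ x → pl x (suc (suc r))) + 1 ≡⟨ cong (λ b → count 0 r (λ x → pl x (suc (suc r))) + bit b) (sym pl-a) ⟩
    count 0 r (λ x → pl x (suc (suc r))) + bit (pl (suc r) (suc (suc r))) ≡⟨ sym (count-suc 0 r _ (s≤s z≤n)) ⟩
    τ (suc (suc r))                          ∎
    where open ≤-Reasoning

  part : ℕ → ℕ
  part a = d a + τ a

  part-mono : ∀ a a′ → 1 ≤ a → a ≤ a′ → a′ ≤ k → part a ≤ part a′
  part-mono a a′ 1≤a a≤a′ a′≤k = +-mono-≤ (d-mono a a′ 1≤a a≤a′ a′≤k) (τ-mono a a′ a≤a′ a′≤k)

  -- part a ≤ 2m + (a - 1) ≤ 2m + k - 1 = 2n - 1 - k.
  part-bound : ∀ a → 1 ≤ a → a ≤ k → part a ≤ 2 * n ∸ 1 ∸ k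
  part-bound (suc r) _ 1+r≤k = m+n≤o⇒m≤o∸n (part (suc r)) (m+n≤o⇒m≤o∸n (part (suc r) + k) (begin
    part (suc r) + k + 1 ≤⟨ +-monoˡ-≤ 1 (+-monoˡ-≤ k (+-mono-≤ (d≤2m (suc r)) (τ≤ r))) ⟩
    2 * m + r + k + 1    ≡⟨ regroup m r k ⟩
    2 * m + (suc r + k)  ≤⟨ +-monoʳ-≤ (2 * m) (+-monoˡ-≤ k 1+r≤k) ⟩
    2 * m + (k + k)      ≡⟨ double m k ⟩
    2 * (m + k)          ≡⟨ cong (2 *_) (m∸n+n≡m (<⇒≤ k<n)) ⟩
    2 * n                ∎))
    where
    open ≤-Reasoning
    regroup : ∀ x y z → 2 * x + y + z + 1 ≡ 2 * x + (suc y + z)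
    regroup = ℕ-Ring.solve-∀
    double : ∀ x y → 2 * x + (y + y) ≡ 2 * (x + y)
    double = ℕ-Ring.solve-∀

  part-strict : ∀ a → 1 ≤ a → suc a ≤ k → m < part (suc a) → part a < part (suc a)
  part-strict a 1≤a 1+a≤k m<part = by-cases (pl a (suc a))
    (λ pl-a → +-mono-≤-< (d-mono a (suc a) 1≤a (n≤1+n a) 1+a≤k) (τ-step a 1≤a 1+a≤k pl-a))
    (λ pl-a → begin-strict
      part a       ≡⟨ cong (d a +_) (proj₁ (τ-vanishes a 1≤a 1+a≤k pl-a)) ⟩
      d a + 0      ≡⟨ +-identityʳ (d a) ⟩
      d a          ≤⟨ ≤-half (d-mono a (suc a) 1≤a (n≤1+n a) 1+a≤k)
                             (not-in-top⇒sum≤ a (suc a) 1≤a ≤-refl 1+a≤k pl-a) ⟩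
      m            <⟨ m<part ⟩
      part (suc a) ∎)
    where open ≤-Reasoning

  -- Parts equal to m are exactly the critical rows, up to moving upward along
  -- top roots e_{a-1} + e_a: a part m comes from a critical row with empty
  -- column, and a critical row either has empty column or a critical row above it.
  part≡m⇒d≡m : ∀ a → 1 ≤ a → a ≤ k → part a ≡ m → d a ≡ m
  part≡m⇒d≡m (suc zero) _ _ part≡m = trans (sym (+-identityʳ _)) part≡m
  part≡m⇒d≡m (suc (suc r)) _ 2+r≤k part≡m = by-cases (pl (suc r) (suc (suc r)))
    (λ pl-r → contradiction (in-top⇒sum≥ (suc r) (suc (suc r)) (s≤s z≤n) ≤-refl 2+r≤k pl-r) (<⇒≱ (sum<2m pl-r)))
    (λ pl-r → trans (sym (trans (cong (d (suc (suc r)) +_) (proj₂ (τ-vanishes (suc r) (s≤s z≤n) 2+r≤k pl-r)))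
                                (+-identityʳ _))) part≡m)
    where
    open ≤-Reasoning
    row-below-m : pl (suc r) (suc (suc r)) ≡ true → d (suc (suc r)) < m
    row-below-m pl-r = begin-strict
      d (suc (suc r))                   <⟨ m<m+n _ (<-≤-trans (s≤s z≤n) (τ-step (suc r) (s≤s z≤n) 2+r≤k pl-r)) ⟩
      d (suc (suc r)) + τ (suc (suc r)) ≡⟨ part≡m ⟩
      m                                 ∎
    sum<2m : pl (suc r) (suc (suc r)) ≡ true → d (suc r) + d (suc (suc r)) < 2 * m
    sum<2m pl-r = begin-strict
      d (suc r) + d (suc (suc r)) <⟨ +-mono-≤-< (≤-trans (d-mono (suc r) (suc (suc r)) (s≤s z≤n) (n≤1+n _) 2+r≤k)
                                                          (<⇒≤ (row-below-m pl-r)))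
                                                (row-below-m pl-r) ⟩
      m + m                       ≡⟨ cong (m +_) (sym (+-identityʳ m)) ⟩
      2 * m                       ∎

  CriticalRow : Set
  CriticalRow = ∃ λ a → 1 ≤ a × a ≤ k × d a ≡ m

  PartEqualsM : Set
  PartEqualsM = ∃ λ a → 1 ≤ a × a ≤ k × part a ≡ m

  critical⇒part≡m : ∀ a → 1 ≤ a → a ≤ k → d a ≡ m → PartEqualsM
  critical⇒part≡m (suc zero) 1≤a a≤k d≡m = 1 , 1≤a , a≤k , trans (+-identityʳ _) d≡m
  critical⇒part≡m (suc (suc r)) _ 2+r≤k d≡m = by-cases (pl (suc r) (suc (suc r)))
    (λ pl-r → critical⇒part≡m (suc r) (s≤s z≤n) (<⇒≤ 2+r≤k) (≤-antisym d≤ (m≤ pl-r)))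
    (λ pl-r → suc (suc r) , s≤s z≤n , 2+r≤k ,
       trans (cong (d (suc (suc r)) +_) (proj₂ (τ-vanishes (suc r) (s≤s z≤n) 2+r≤k pl-r))) (trans (+-identityʳ _) d≡m))
    where
    d≤ : d (suc r) ≤ m
    d≤ = ≤-trans (d-mono (suc r) (suc (suc r)) (s≤s z≤n) (n≤1+n _) 2+r≤k) (≤-reflexive d≡m)
    m≤ : pl (suc r) (suc (suc r)) ≡ true → m ≤ d (suc r)
    m≤ pl-r = +-cancelʳ-≤ m m (d (suc r)) (begin
      m + m                       ≡⟨ cong (m +_) (+-identityʳ m) ⟨
      2 * m                       ≤⟨ in-top⇒sum≥ (suc r) (suc (suc r)) (s≤s z≤n) ≤-refl 2+r≤k pl-r ⟩
      d (suc r) + d (suc (suc r)) ≡⟨ cong (d (suc r) +_) d≡m ⟩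
      d (suc r) + m               ∎)
      where open ≤-Reasoning

  part≡m⇔critical : PartEqualsM ⇔ CriticalRow
  part≡m⇔critical = mk⇔ (λ (a , 1≤a , a≤k , part≡m) → a , 1≤a , a≤k , part≡m⇒d≡m a 1≤a a≤k part≡m)
                        (λ (a , 1≤a , a≤k , d≡m) → critical⇒part≡m a 1≤a a≤k d≡m)

  criticalUp criticalDown : ℕ → Bool
  criticalUp a   = (d a ≡ᵇ m) ∧ mn a n
  criticalDown a = (d a ≡ᵇ m) ∧ pl a n

  tag-none : ¬ CriticalRow → tag k n S ≡ 0
  tag-none none = trans (cong (λ b → if b then 1 else if down k n S then 2 else 0) up≡false)
                        (cong (λ b → if b then 2 else 0) down≡false)
    where
    not-critical : ∀ a → 1 ≤ a → a ≤ k → (d a ≡ᵇ m) ≡ false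
    not-critical a 1≤a a≤k = ≡ᵇ-false λ d≡m → none (a , 1≤a , a≤k , d≡m)
    up≡false : up k n S ≡ false
    up≡false = anyRow-none k criticalUp λ a 1≤a a≤k → cong (_∧ mn a n) (not-critical a 1≤a a≤k)
    down≡false : down k n S ≡ false
    down≡false = anyRow-none k criticalDown λ a 1≤a a≤k → cong (_∧ pl a n) (not-critical a 1≤a a≤k)

  tag-up : ∀ a → 1 ≤ a → a ≤ k → d a ≡ m → mn a n ≡ true → tag k n S ≡ 1
  tag-up a 1≤a a≤k d≡m mn-an = cong (λ b → if b then 1 else if down k n S then 2 else 0) up≡true
    where
    up≡true : up k n S ≡ true
    up≡true = anyRow-intro k criticalUp a 1≤a a≤k
      (cong₂ _∧_ (trans (cong (_≡ᵇ m) d≡m) (≡ᵇ-true m)) mn-an)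

  tag-down : ∀ a → 1 ≤ a → a ≤ k → d a ≡ m → mn a n ≡ false → tag k n S ≡ 2
  tag-down a 1≤a a≤k d≡m mn-an = trans (cong (λ b → if b then 1 else if down k n S then 2 else 0) up≡false)
                                       (cong (λ b → if b then 2 else 0) down≡true)
    where
    up≡false : up k n S ≡ false
    up≡false = anyRow-none k criticalUp λ b 1≤b b≤k → ≢true⇒false λ up-b →
      let (db≡ᵇm , mn-bn) = ∧-true up-b
          db≡m = ≡ᵇ-true⁻¹ (d b) m db≡ᵇm
      in true≢false (trans (sym mn-bn) (trans (critical-rows-agree b a 1≤b b≤k 1≤a a≤k db≡m d≡m) mn-an))
    down≡true : down k n S ≡ true
    down≡true = anyRow-intro k criticalDown a 1≤a a≤k
      (cong₂ _∧_ (trans (cong (_≡ᵇ m) d≡m) (≡ᵇ-true m)) (critical-¬minus⇒plus a 1≤a a≤k d≡m mn-an))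

  γ : Vec ℕ k
  γ = proj₁ (F k n S)

  F-entry : ∀ (i : Fin k) → lookup γ i ≡ part (k ∸ toℕ i)
  F-entry i = begin
    lookup γ i
      ≡⟨ lookup∘tabulate _ i ⟩
    d (k ∸ toℕ i) + sumℕ (k ∸ suc (toℕ i)) (λ x → bit (pl x (k ∸ toℕ i)))
      ≡⟨ cong (d (k ∸ toℕ i) +_) (top-sum (k ∸ toℕ i) (sym (row-above i))) ⟩
    part (k ∸ toℕ i)
      ∎
    where
    open ≡-Reasoning
    top-sum : ∀ b → b ≡ suc (k ∸ suc (toℕ i)) → sumℕ (k ∸ suc (toℕ i)) (λ x → bit (pl x b)) ≡ τ b
    top-sum b refl = sumℕ-cong (k ∸ suc (toℕ i)) λ { (suc x) _ _ → refl }

  entry≡m⇔part≡m : (∃ λ (i : Fin k) → lookup γ i ≡ m) ⇔ PartEqualsM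
  entry≡m⇔part≡m = mk⇔
    (λ (i , γi≡m) → let (1≤a , a≤k) = row-of i in k ∸ toℕ i , 1≤a , a≤k , trans (sym (F-entry i)) γi≡m)
    (λ (a , 1≤a , a≤k , part≡m) → let (i , i↦a) = fin-of-row k a 1≤a a≤k in
                                  i , trans (F-entry i) (trans (cong part i↦a) part≡m))

  S¹≡m⇔critical : (∃ λ (i : Fin k) → S¹ k n S (suc (toℕ i)) ≡ m) ⇔ CriticalRow
  S¹≡m⇔critical = mk⇔
    (λ (i , d≡m) → let (1≤a , a≤k) = row-of i in k ∸ toℕ i , 1≤a , a≤k , d≡m)
    (λ (a , 1≤a , a≤k , d≡m) → let (i , i↦a) = fin-of-row k a 1≤a a≤k in i , trans (cong d i↦a) d≡m)

  entry≡m⇔S¹≡m : (∃ λ (i : Fin k) → lookup γ i ≡ m) ⇔ (∃ λ (i : Fin k) → S¹ k n S (suc (toℕ i)) ≡ m)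
  entry≡m⇔S¹≡m = ⇔-sym S¹≡m⇔critical ⇔-∘ (part≡m⇔critical ⇔-∘ entry≡m⇔part≡m)

  F-nonincreasing : ∀ (i j : Fin k) → toℕ i ≤ toℕ j → lookup γ j ≤ lookup γ i
  F-nonincreasing i j i≤j rewrite F-entry i | F-entry j =
    part-mono (k ∸ toℕ j) (k ∸ toℕ i) (proj₁ (row-of j)) (∸-monoʳ-≤ k i≤j) (proj₂ (row-of i))

  F-bounded : ∀ (i : Fin k) → lookup γ i ≤ 2 * n ∸ 1 ∸ k
  F-bounded i rewrite F-entry i = part-bound (k ∸ toℕ i) (proj₁ (row-of i)) (proj₂ (row-of i))

  F-strict : ∀ (i j : Fin k) → toℕ j ≡ suc (toℕ i) → m < lookup γ i → lookup γ j < lookup γ i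
  F-strict i j j≡1+i m<γi = begin-strict
    lookup γ j                 ≡⟨ F-entry j ⟩
    part (k ∸ toℕ j)           ≡⟨ cong (λ t → part (k ∸ t)) j≡1+i ⟩
    part a                     <⟨ subst (λ b → part a < part b) (row-above i) (part-strict a 1≤a a<k m<next) ⟩
    part (k ∸ toℕ i)           ≡⟨ F-entry i ⟨
    lookup γ i                 ∎
    where
    open ≤-Reasoning
    a : ℕ
    a = k ∸ suc (toℕ i)
    1≤a : 1 ≤ a
    1≤a = subst (λ t → 1 ≤ k ∸ t) j≡1+i (proj₁ (row-of j))
    a<k : suc a ≤ k
    a<k = subst (_≤ k) (sym (row-above i)) (proj₂ (row-of i))
    m<next : m < part (suc a)
    m<next = subst (λ b → m < part b) (sym (row-above i)) (subst (m <_) (F-entry i) m<γi)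

  F-tag-none : ¬ (∃ λ (i : Fin k) → lookup γ i ≡ m) → tag k n S ≡ 0
  F-tag-none no-entry = tag-none λ critical →
    no-entry (Equivalence.from entry≡m⇔part≡m (Equivalence.from part≡m⇔critical critical))

  F-tag-some : (∃ λ (i : Fin k) → lookup γ i ≡ m) → tag k n S ≡ 1 ⊎ tag k n S ≡ 2
  F-tag-some entry with Equivalence.to part≡m⇔critical (Equivalence.to entry≡m⇔part≡m entry)
  ... | a , 1≤a , a≤k , d≡m = by-cases (mn a n)
    (λ mn-an → inj₁ (tag-up a 1≤a a≤k d≡m mn-an))
    (λ mn-an → inj₂ (tag-down a 1≤a a≤k d≡m mn-an))

  F∈P̃ : P̃ k n (F k n S)
  F∈P̃ = F-nonincreasing , F-bounded , F-strict , F-tag-none , F-tag-some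

-- Comparing two elements of Θ(k, 2n) whose rows agree above row r + 1: if row
-- r + 1 of S is shorter than that of S′, then so is its top column (every top root
-- e_x + e_{r+1} of S is forced into S′ by the threshold rule), hence so is its part.
module Comparison (k n : ℕ) (k<n : k < n) (S S′ : RootSet) (θ : Θ k n S) (θ′ : Θ k n S′) where
  module A = Staircase k n k<n S θ
  module B = Staircase k n k<n S′ θ′

  τ-≤-when-d-< : ∀ r → suc r ≤ k → (∀ x → 1 ≤ x → x ≤ r → A.d x ≡ B.d x) →
                 A.d (suc r) < B.d (suc r) → A.τ (suc r) ≤ B.τ (suc r)
  τ-≤-when-d-< r 1+r≤k same-above shorter = count-mono 0 r forced
    where
    forced : ∀ x → 0 < x → x ≤ r → A.pl x (suc r) ≡ true → B.pl x (suc r) ≡ true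
    forced x 0<x x≤r pl-x = B.above-threshold x (suc r) 0<x (s≤s x≤r) 1+r≤k (begin-strict
      2 * A.m                     ≤⟨ A.in-top⇒sum≥ x (suc r) 0<x (s≤s x≤r) 1+r≤k pl-x ⟩
      A.d x + A.d (suc r)         <⟨ +-monoʳ-< (A.d x) shorter ⟩
      A.d x + B.d (suc r)         ≡⟨ cong (_+ B.d (suc r)) (same-above x 0<x x≤r) ⟩
      B.d x + B.d (suc r)         ∎)
      where open ≤-Reasoning

  part-<-when-d-< : ∀ r → suc r ≤ k → (∀ x → 1 ≤ x → x ≤ r → A.d x ≡ B.d x) →
                    A.d (suc r) < B.d (suc r) → A.part (suc r) < B.part (suc r)
  part-<-when-d-< r 1+r≤k same-above shorter = +-mono-<-≤ shorter (τ-≤-when-d-< r 1+r≤k same-above shorter)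

  -- With equal row counts and equal tags, a row cannot contain e_a - e_n in S
  -- but not in S′: critical rows would get different tags, other rows different counts.
  minus-last-not-split : ∀ a → 1 ≤ a → a ≤ k → A.d a ≡ B.d a → tag k n S ≡ tag k n S′ →
                         A.mn a n ≡ true → B.mn a n ≢ false
  minus-last-not-split a 1≤a a≤k same-d same-tag mnA mnB with A.d a ≟ A.m
  ... | yes critical = contradiction
    (trans (sym (A.tag-up a 1≤a a≤k critical mnA)) (trans same-tag (B.tag-down a 1≤a a≤k (trans (sym same-d) critical) mnB)))
    (λ ())
  ... | no not-critical = not-critical
    (≤-antisym (≤-trans (≤-reflexive same-d) (B.d≤m a 1≤a a≤k mnB)) (A.m≤d a 1≤a a≤k mnA))

-- Equal parts give equal row
-- counts d (row by row from the top, by Comparison) and hence equal top counts τ.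
-- For each row the tag (critical rows) or d (other rows) decides whether e_a - e_n
-- lies in S; the row is then a segment determined by its count, and so is each
-- top column.
module Injectivity (k n : ℕ) (k<n : k < n) (S S′ : RootSet) (θ : Θ k n S) (θ′ : Θ k n S′)
                   (same-F : F k n S ≡ F k n S′) where
  module A = Staircase k n k<n S θ
  module B = Staircase k n k<n S′ θ′

  part-agree : ∀ a → 1 ≤ a → a ≤ k → A.part a ≡ B.part a
  part-agree a 1≤a a≤k with fin-of-row k a 1≤a a≤k
  ... | i , refl = trans (sym (A.F-entry i)) (trans (cong (λ γ → lookup (proj₁ γ) i) same-F) (B.F-entry i))

  d-agree : ∀ a → a ≤ k → ∀ x → 1 ≤ x → x ≤ a → A.d x ≡ B.d x
  d-agree zero    _     x 1≤x x≤0 = contradiction (≤-trans 1≤x x≤0) (λ ())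
  d-agree (suc r) 1+r≤k x 1≤x x≤1+r with x ≟ suc r
  ... | no x≢1+r = d-agree r (<⇒≤ 1+r≤k) x 1≤x (≤-pred (≤∧≢⇒< x≤1+r x≢1+r))
  ... | yes refl with <-cmp (A.d (suc r)) (B.d (suc r))
  ...   | tri≈ _ same _ = same
  ...   | tri< shorter _ _ = contradiction (part-agree (suc r) 1≤x 1+r≤k)
    (<⇒≢ (Comparison.part-<-when-d-< k n k<n S S′ θ θ′ r 1+r≤k (d-agree r (<⇒≤ 1+r≤k)) shorter))
  ...   | tri> _ _ longer = contradiction (sym (part-agree (suc r) 1≤x 1+r≤k))
    (<⇒≢ (Comparison.part-<-when-d-< k n k<n S′ S θ′ θ r 1+r≤k
           (λ y 1≤y y≤r → sym (d-agree r (<⇒≤ 1+r≤k) y 1≤y y≤r)) longer))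

  row-counts-agree : ∀ a → 1 ≤ a → a ≤ k → A.d a ≡ B.d a
  row-counts-agree a 1≤a a≤k = d-agree a a≤k a 1≤a ≤-refl

  τ-agree : ∀ a → 1 ≤ a → a ≤ k → A.τ a ≡ B.τ a
  τ-agree a 1≤a a≤k = +-cancelˡ-≡ (A.d a) _ _
    (trans (part-agree a 1≤a a≤k) (cong (_+ B.τ a) (sym (row-counts-agree a 1≤a a≤k))))

  minus-last-agree : ∀ a → 1 ≤ a → a ≤ k → A.mn a n ≡ B.mn a n
  minus-last-agree a 1≤a a≤k = bool-ext
    (Comparison.minus-last-not-split k n k<n S S′ θ θ′ a 1≤a a≤k (row-counts-agree a 1≤a a≤k) (cong proj₂ same-F))
    (Comparison.minus-last-not-split k n k<n S′ S θ′ θ a 1≤a a≤k (sym (row-counts-agree a 1≤a a≤k)) (cong proj₂ (sym same-F)))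

  minus-last-transfer : ∀ a {b} → 1 ≤ a → a ≤ k → A.mn a n ≡ b → B.mn a n ≡ b
  minus-last-transfer a 1≤a a≤k mnA = trans (sym (minus-last-agree a 1≤a a≤k)) mnA

  -- Rows containing e_a - e_n: all minus roots, and a final segment of plus roots of known size.
  full-rows-agree : ∀ a s → 1 ≤ a → a ≤ k → A.mn a n ≡ true → ∀ c → k < c → c ≤ n → S (a , c , s) ≡ S′ (a , c , s)
  full-rows-agree a minus 1≤a a≤k mnA c k<c c≤n =
    trans (A.minus-down a 1≤a a≤k c n k<c c≤n ≤-refl mnA)
          (sym (B.minus-down a 1≤a a≤k c n k<c c≤n ≤-refl (minus-last-transfer a 1≤a a≤k mnA)))
  full-rows-agree a plus 1≤a a≤k mnA =
    up-closed-count-determines k n (A.plus-up a 1≤a a≤k) (B.plus-up a 1≤a a≤k) same-plus-count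
    where
    open ≡-Reasoning
    same-plus-count : count k n (A.pl a) ≡ count k n (B.pl a)
    same-plus-count = +-cancelˡ-≡ A.m _ _ (begin
      A.m + count k n (A.pl a)                ≡⟨ cong (_+ count k n (A.pl a)) (A.minus-full a 1≤a a≤k mnA) ⟨
      count k n (A.mn a) + count k n (A.pl a) ≡⟨ A.d-split a ⟨
      A.d a                                   ≡⟨ row-counts-agree a 1≤a a≤k ⟩
      B.d a                                   ≡⟨ B.d-split a ⟩
      count k n (B.mn a) + count k n (B.pl a) ≡⟨ cong (_+ count k n (B.pl a))
                                                   (B.minus-full a 1≤a a≤k (minus-last-transfer a 1≤a a≤k mnA)) ⟩
      B.m + count k n (B.pl a)                ∎)

  -- Rows without e_a - e_n: an initial segment of the staircase of known size.
  staircases-agree : ∀ a → 1 ≤ a → a ≤ k → A.mn a n ≡ false → ∀ c → k < c → c ≤ n → A.staircase a c ≡ B.staircase a c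
  staircases-agree a 1≤a a≤k mnA = down-closed-count-determines k n
    (A.staircase-down a 1≤a a≤k mnA) (B.staircase-down a 1≤a a≤k mnB)
    (trans (sym (A.d-staircase a 1≤a a≤k mnA)) (trans (row-counts-agree a 1≤a a≤k) (B.d-staircase a 1≤a a≤k mnB)))
    where
    mnB : B.mn a n ≡ false
    mnB = minus-last-transfer a 1≤a a≤k mnA

  open-rows-agree : ∀ a s → 1 ≤ a → a ≤ k → A.mn a n ≡ false → ∀ c → k < c → c ≤ n → S (a , c , s) ≡ S′ (a , c , s)
  open-rows-agree a s 1≤a a≤k mnA c k<c c≤n with c <? n | s
  ... | yes c<n | minus = trans (sym (A.staircase-minus a c c<n))
    (trans (staircases-agree a 1≤a a≤k mnA c k<c c≤n) (B.staircase-minus a c c<n))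
  ... | yes c<n | plus  = trans (A.plus-absent a c 1≤a a≤k k<c c<n mnA)
    (sym (B.plus-absent a c 1≤a a≤k k<c c<n (minus-last-transfer a 1≤a a≤k mnA)))
  ... | no c≮n | s′ with ≤-antisym c≤n (≮⇒≥ c≮n)
  ...   | refl with s′
  ...     | minus = minus-last-agree a 1≤a a≤k
  ...     | plus  = trans (sym (A.staircase-last a)) (trans (staircases-agree a 1≤a a≤k mnA n k<n ≤-refl) (B.staircase-last a))

  base-agree : ∀ α → InBase k n α → S α ≡ S′ α
  base-agree (a , c , s) (1≤a , a≤k , k<c , c≤n) = by-cases (A.mn a n)
    (λ mnA → full-rows-agree a s 1≤a a≤k mnA c k<c c≤n)
    (λ mnA → open-rows-agree a s 1≤a a≤k mnA c k<c c≤n)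

  -- Each top column is a final segment of known size.
  top-agree : ∀ α → InTop k α → S α ≡ S′ α
  top-agree (a , suc r , .plus) (refl , 1≤a , s≤s a≤r , 1+r≤k) =
    up-closed-count-determines 0 r (A.column-up r 1+r≤k) (B.column-up r 1+r≤k) (τ-agree (suc r) (s≤s z≤n) 1+r≤k) a 1≤a a≤r

  outside-agree : ∀ α → ¬ InBase k n α → ¬ InTop k α → S α ≡ S′ α
  outside-agree α ¬base ¬top = trans (A.absent-outside α ¬base ¬top) (sym (B.absent-outside α ¬base ¬top))

  S≗S′ : ∀ α → S α ≡ S′ α
  S≗S′ α with inBase? k n α | inTop? k α
  ... | yes base | _       = base-agree α base
  ... | no ¬base | yes top = top-agree α top
  ... | no ¬base | no ¬top = outside-agree α ¬base ¬top

lemma3p16 : (k n : ℕ) → 1 ≤ k → k < n →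
    ((S : RootSet) → Θ k n S →
      P̃ k n (F k n S) ×
      ((∃ λ (i : Fin k) → lookup (proj₁ (F k n S)) i ≡ n ∸ k)
        ⇔ (∃ λ (i : Fin k) → S¹ k n S (suc (toℕ i)) ≡ n ∸ k))) ×
    ((S S′ : RootSet) → Θ k n S → Θ k n S′ → F k n S ≡ F k n S′ → ∀ α → S α ≡ S′ α)
lemma3p16 k n _ k<n =
  (λ S θ → Staircase.F∈P̃ k n k<n S θ , Staircase.entry≡m⇔S¹≡m k n k<n S θ) ,
  (λ S S′ θ θ′ same-F → Injectivity.S≗S′ k n k<n S S′ θ θ′ same-F)
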